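{- Let $G$ be a non-empty finite simple graph, and let $H=P_n$ (the path on $n$ vertices) or $H=C_n$ (the cycle on $n$ vertices). Then $$\gamma_R(G\boxtimes H)\le \begin{cases} \frac{2n+1}{3}\gamma_R(G)-2\left\lfloor\frac{n}{3}\right\rfloor, & n\equiv 1 \pmod 3,\\[4pt] 2\left\lceil\frac{n}{3}\right\rceil\gamma_R(G)-2\left\lfloor\frac{n}{3}\right\rfloor, & n\not\equiv 1 \pmod 3.\end{cases}$$
   Context: A graph is non-empty if it has at least one edge. A Roman dominating function on a graph $X$ is a map $f:V(X)\to\{0,1,2\}$ such that every vertex $v$ with $f(v)=0$ has a neighbor $u$ with $f(u)=2$; $\gamma_R(X)$ is the minimum of $\sum_v f(v)$ over such $f$. The strong product $G\boxtimes H$ has vertex set $V(G)\times V(H)$, with distinct $(g,h),(g',h')$ adjacent iff ($g=g'$ and $h\sim h'$) or ($g\sim g'$ and $h=h'$) or ($g\sim g'$ and $h\sim h'$). -}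

module Defs where

open import Data.Nat using (ℕ; zero; suc; _+_; _*_; _∸_; _≤_; _/_)
open import Data.Fin using (Fin; toℕ; combine)
open import Data.List using (map; allFin)
open import Data.Nat.ListAction using (sum)
open import Data.Product using (Σ; ∃; _×_; _,_)
open import Data.Sum using (_⊎_)
open import Data.Empty using (⊥)
open import Relation.Binary.PropositionalEquality using (_≡_)
open import Relation.Nullary using (¬_)

record Graph : Set₁ where
  field
    order : ℕ
    Adj   : Fin order → Fin order → Set
open Graph public

IsSimple : Graph → Set
IsSimple G = (∀ u v → Adj G u v → Adj G v u) × (∀ v → ¬ Adj G v v)

NonEmpty : Graph → Set
NonEmpty G = ∃ λ u → ∃ λ v → Adj G u v

IsRDF : (G : Graph) → (Fin (order G) → ℕ) → Set
IsRDF G f = (∀ v → f v ≤ 2) ×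
            (∀ v → f v ≡ 0 → ∃ λ u → Adj G v u × f u ≡ 2)

weight : (G : Graph) → (Fin (order G) → ℕ) → ℕ
weight G f = sum (map f (allFin (order G)))

IsRomanDominationNumber : Graph → ℕ → Set
IsRomanDominationNumber G k =
  (Σ (Fin (order G) → ℕ) λ f → IsRDF G f × weight G f ≡ k) ×
  (∀ f → IsRDF G f → k ≤ weight G f)

_⊠_ : Graph → Graph → Graph
G ⊠ H = record
  { order = order G * order H
  ; Adj = λ x y → ∃ λ g → ∃ λ h → ∃ λ g' → ∃ λ h' →
            x ≡ combine g h × y ≡ combine g' h' ×
            ((g ≡ g' × Adj H h h') ⊎ (Adj G g g' × h ≡ h') ⊎ (Adj G g g' × Adj H h h'))
  }

pathAdj : (n : ℕ) → Fin n → Fin n → Set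
pathAdj n i j = (toℕ j ≡ suc (toℕ i)) ⊎ (toℕ i ≡ suc (toℕ j))

pathGraph : ℕ → Graph
pathGraph n = record { order = n ; Adj = pathAdj n }

cycleGraph : ℕ → Graph
cycleGraph n = record
  { order = n
  ; Adj = λ i j → pathAdj n i j
                  ⊎ (toℕ i ≡ 0 × toℕ j ≡ n ∸ 1)
                  ⊎ (toℕ j ≡ 0 × toℕ i ≡ n ∸ 1)
  }

⌈_/3⌉ : ℕ → ℕ
⌈ n /3⌉ = (n + 2) / 3

-- A non-empty graph has a dominating set D with |D| < γ_R(G): double the
-- support of an optimal Roman dominating function f if f takes the value 2,
-- and otherwise f ≡ 1 and all vertices but one end of an edge dominate.
-- Cut P_n (or C_n ⊇ P_n) into n mod 3 leading vertices followed by ⌊n/3⌋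
-- triples, and label each vertex of H "double" (2·𝟙_D on that copy of G),
-- "roman" (f on that copy) or "blank" (0), such that every blank vertex of H
-- has a double neighbour: a triple is blank–double–blank, and the remainder
-- is nothing, a single roman vertex, or blank–double. The resulting function
-- on G ⊠ H is Roman dominating, since a 0 in a blank copy is dominated
-- vertically or diagonally from the adjacent double copy. Its weight is
-- 2|D| ≤ 2γ_R(G) − 2 for each double copy plus γ_R(G) for a roman copy.
module Submission where

open import Defs
open import Data.Nat using (ℕ; zero; suc; _+_; _*_; _≤_; _<_; _/_; _%_; z≤n; s≤s)
open import Data.Nat.Properties
open import Data.Nat.DivMod using (_mod_; m≡m%n+[m/n]*n; m%n<n; m<n⇒m/n≡0; m/n≡1+[m∸n]/n; /-congˡ)
open import Data.Nat.Solver using (module +-*-Solver)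
import Data.Nat.ListAction as List
open import Data.Integer using (+_; _-_; +≤+) renaming (_≤_ to _≤ℤ_)
open import Data.Integer.Properties using (m-n≡m⊖n; ⊖-≥)
open import Data.Fin using (Fin; zero; suc; toℕ; combine; remQuot; splitAt; _↑ˡ_; _↑ʳ_)
  renaming (_≟_ to _≟ᶠ_)
open import Data.Fin.Properties
  using (remQuot-combine; combine-remQuot; splitAt⁻¹-↑ˡ; splitAt⁻¹-↑ʳ; toℕ-↑ˡ; toℕ-↑ʳ; toℕ-fromℕ<; any?)
open import Data.Vec.Functional using (Vector; []; _∷_; _++_)
open import Data.Vec.Functional.Properties using (lookup-++ˡ; lookup-++ʳ)
open import Data.List using (tabulate)
open import Data.List.Properties using (map-tabulate)
open import Algebra.Properties.Semiring.Sum +-*-semiring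
  using (sum; sum-cong-≗; sum-remove; ∑-distrib-+; *-distribˡ-sum; *-distribʳ-sum)
open import Data.Product using (Σ; ∃; _×_; _,_; proj₁; proj₂; uncurry; map₁; map₂)
open import Data.Sum using (_⊎_; inj₁; inj₂) renaming (map to map-⊎)
open import Data.Empty using (⊥-elim)
open import Function using (_∘_; id)
open import Relation.Nullary using (¬_; yes; no; contradiction)
open import Relation.Binary.PropositionalEquality
  using (_≡_; refl; sym; trans; cong; cong₂; subst; module ≡-Reasoning)

sum-tabulate : ∀ {n} (t : Vector ℕ n) → List.sum (tabulate t) ≡ sum t
sum-tabulate {zero}  t = refl
sum-tabulate {suc n} t = cong (_+_ (t zero)) (sum-tabulate (t ∘ suc))

weight≡sum : ∀ G f → weight G f ≡ sum f
weight≡sum G f = trans (cong List.sum (map-tabulate id f)) (sum-tabulate f)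

sum-↑ : ∀ m {n} (t : Vector ℕ (m + n)) →
        sum t ≡ sum (t ∘ (_↑ˡ n)) + sum (t ∘ (m ↑ʳ_))
sum-↑ zero    t = refl
sum-↑ (suc m) {n} t = trans (cong (_+_ (t zero)) (sum-↑ m {n} (t ∘ suc))) (sym (+-assoc (t zero) _ _))

sum-map-++ : ∀ {A : Set} {m n} (w : A → ℕ) (xs : Vector A m) (ys : Vector A n) →
             sum (w ∘ (xs ++ ys)) ≡ sum (w ∘ xs) + sum (w ∘ ys)
sum-map-++ {m = m} w xs ys = trans (sum-↑ m (w ∘ (xs ++ ys)))
  (cong₂ _+_ (sum-cong-≗ (cong w ∘ lookup-++ˡ xs ys)) (sum-cong-≗ (cong w ∘ lookup-++ʳ xs ys)))

sum-combine : ∀ m n (t : Vector ℕ (m * n)) →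
              sum t ≡ sum (λ i → sum (λ j → t (combine {m} {n} i j)))
sum-combine zero    n t = refl
sum-combine (suc m) n t = trans (sum-↑ n t) (cong (_+_ _) (sum-combine m n (t ∘ (n ↑ʳ_))))

sum-mono-≤ : ∀ {n} {s t : Vector ℕ n} → (∀ i → s i ≤ t i) → sum s ≤ sum t
sum-mono-≤ {zero}  s≤t = z≤n
sum-mono-≤ {suc n} s≤t = +-mono-≤ (s≤t zero) (sum-mono-≤ (s≤t ∘ suc))

lookup≤sum : ∀ {n} (t : Vector ℕ n) i → t i ≤ sum t
lookup≤sum {suc n} t i = ≤-trans (m≤m+n (t i) _) (≤-reflexive (sym (sum-remove {i = i} t)))

sum-linearˡ : ∀ {n} a b (s t : Vector ℕ n) →
              sum (λ i → a * s i + b * t i) ≡ a * sum s + b * sum t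
sum-linearˡ a b s t = trans (∑-distrib-+ (λ i → a * s i) (λ i → b * t i))
  (sym (cong₂ _+_ (*-distribˡ-sum a s) (*-distribˡ-sum b t)))

sum-linearʳ : ∀ {n} a b (s t : Vector ℕ n) →
              sum (λ i → s i * a + t i * b) ≡ sum s * a + sum t * b
sum-linearʳ a b s t = trans (∑-distrib-+ (λ i → s i * a) (λ i → t i * b))
  (sym (cong₂ _+_ (*-distribʳ-sum a s) (*-distribʳ-sum b t)))

sum-≤-surplus : ∀ {n} {s t u : Vector ℕ n} {c} i →
                (∀ j → s j + t j ≤ u j) → c ≤ t i → sum s + c ≤ sum u
sum-≤-surplus {s = s} {t} {u} i s+t≤u c≤tᵢ = begin
  sum s + _                 ≤⟨ +-monoʳ-≤ (sum s) (≤-trans c≤tᵢ (lookup≤sum t i)) ⟩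
  sum s + sum t             ≡⟨ ∑-distrib-+ s t ⟨
  sum (λ j → s j + t j)     ≤⟨ sum-mono-≤ s+t≤u ⟩
  sum u                     ∎
  where open ≤-Reasoning

-- Dominating sets below the Roman domination number

IsDoubledDominatingSet : (G : Graph) → (Fin (order G) → ℕ) → Set
IsDoubledDominatingSet G φ =
  (∀ v → φ v ≡ 0 ⊎ φ v ≡ 2) × (∀ v → φ v ≡ 0 → ∃ λ u → Adj G v u × φ u ≡ 2)

DominatingSetSmallerThan : Graph → ℕ → Set
DominatingSetSmallerThan G w =
  Σ (Fin (order G) → ℕ) λ φ → IsDoubledDominatingSet G φ × weight G φ + 2 ≤ 2 * w

smallerThan-bySurplus : ∀ {G} {φ f e : Fin (order G) → ℕ} v →
  IsDoubledDominatingSet G φ → (∀ g → φ g + e g ≤ 2 * f g) → 2 ≤ e v →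
  DominatingSetSmallerThan G (weight G f)
smallerThan-bySurplus {G} {φ} {f} v φ-dds φ+e≤2f 2≤eᵥ = φ , φ-dds , (begin
  weight G φ + 2          ≡⟨ cong (_+ 2) (weight≡sum G φ) ⟩
  sum φ + 2               ≤⟨ sum-≤-surplus v φ+e≤2f 2≤eᵥ ⟩
  sum (λ g → 2 * f g)     ≡⟨ *-distribˡ-sum 2 f ⟨
  2 * sum f               ≡⟨ cong (2 *_) (weight≡sum G f) ⟨
  2 * weight G f          ∎)
  where open ≤-Reasoning

smallerThan-withTwo : ∀ {G f} v → IsRDF G f → f v ≡ 2 → DominatingSetSmallerThan G (weight G f)
smallerThan-withTwo {G} {f} v (_ , f-dom) fᵥ≡2 =
  smallerThan-bySurplus v (cap-values ∘ f , dominated) (λ g → cap+bonus≤2* (f g))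
    (≤-reflexive (sym (cong bonus fᵥ≡2)))
  where
  cap bonus : ℕ → ℕ
  cap zero    = 0
  cap (suc _) = 2
  bonus 2 = 2
  bonus _ = 0

  cap-values : ∀ x → cap x ≡ 0 ⊎ cap x ≡ 2
  cap-values zero    = inj₁ refl
  cap-values (suc _) = inj₂ refl

  cap+bonus≤2* : ∀ x → cap x + bonus x ≤ 2 * x
  cap+bonus≤2* 0                   = z≤n
  cap+bonus≤2* 1                   = ≤-refl
  cap+bonus≤2* 2                   = ≤-refl
  cap+bonus≤2* (suc (suc (suc _))) = s≤s (s≤s z≤n)

  cap≡0 : ∀ x → cap x ≡ 0 → x ≡ 0
  cap≡0 zero _ = refl

  dominated : ∀ g → cap (f g) ≡ 0 → ∃ λ u → Adj G g u × cap (f u) ≡ 2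
  dominated g cap≡0ᵍ with f-dom g (cap≡0 (f g) cap≡0ᵍ)
  ... | u , g~u , fᵤ≡2 = u , g~u , cong cap fᵤ≡2

smallerThan-allPositive : ∀ {G f a b} → IsSimple G → Adj G a b → (∀ g → 1 ≤ f g) →
                          DominatingSetSmallerThan G (weight G f)
smallerThan-allPositive {G} {f} {a} {b} (symmetric , irreflexive) a~b positive =
  smallerThan-bySurplus b (values , dominated) φ+e≤2f e-at-b
  where
  φ e : Fin (order G) → ℕ
  φ g with g ≟ᶠ b
  ... | yes _ = 0
  ... | no  _ = 2
  e g with g ≟ᶠ b
  ... | yes _ = 2
  ... | no  _ = 0

  values : ∀ g → φ g ≡ 0 ⊎ φ g ≡ 2
  values g with g ≟ᶠ b
  ... | yes _ = inj₁ refl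
  ... | no  _ = inj₂ refl

  φₐ≡2 : φ a ≡ 2
  φₐ≡2 with a ≟ᶠ b
  ... | yes refl = ⊥-elim (irreflexive a a~b)
  ... | no  _    = refl

  dominated : ∀ g → φ g ≡ 0 → ∃ λ u → Adj G g u × φ u ≡ 2
  dominated g φᵍ≡0 with g ≟ᶠ b
  dominated g φᵍ≡0 | yes refl = a , symmetric a g a~b , φₐ≡2
  dominated g ()   | no  _

  φ+e≤2f : ∀ g → φ g + e g ≤ 2 * f g
  φ+e≤2f g with g ≟ᶠ b
  ... | yes _ = *-monoʳ-≤ 2 (positive g)
  ... | no  _ = *-monoʳ-≤ 2 (positive g)

  e-at-b : 2 ≤ e b
  e-at-b with b ≟ᶠ b
  ... | yes _  = ≤-refl
  ... | no b≢b = contradiction refl b≢b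

smallerDominatingSet : ∀ {G f} → IsSimple G → NonEmpty G → IsRDF G f →
                       DominatingSetSmallerThan G (weight G f)
smallerDominatingSet {f = f} simple (a , b , a~b) f-rdf with any? (λ v → f v ≟ 2)
... | yes (v , fᵥ≡2) = smallerThan-withTwo v f-rdf fᵥ≡2
... | no  no-two     = smallerThan-allPositive simple a~b positive
  where
  positive : ∀ g → 1 ≤ f g
  positive g with f g in fᵍ
  ... | suc _ = s≤s z≤n
  ... | zero  with proj₂ f-rdf g fᵍ
  ...   | u , _ , fᵤ≡2 = contradiction (u , fᵤ≡2) no-two

-- Layered functions on a strong product

data Layer : Set where
  blank double roman : Layer

layerValue : Layer → ℕ → ℕ → ℕ
layerValue blank  _ _ = 0
layerValue double a _ = a
layerValue roman  _ b = b

doubleMark romanMark : Layer → ℕ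
doubleMark double = 1
doubleMark _      = 0
romanMark roman = 1
romanMark _     = 0

layerValue-linear : ∀ L a b → layerValue L a b ≡ doubleMark L * a + romanMark L * b
layerValue-linear blank  a b = refl
layerValue-linear double a b = sym (trans (+-identityʳ _) (+-identityʳ a))
layerValue-linear roman  a b = sym (+-identityʳ b)

#doubles #romans : ∀ {n} → Vector Layer n → ℕ
#doubles ℓ = sum (doubleMark ∘ ℓ)
#romans  ℓ = sum (romanMark ∘ ℓ)

BlanksDominated : (H : Graph) → Vector Layer (order H) → Set
BlanksDominated H ℓ = ∀ j → ℓ j ≡ blank → ∃ λ j' → Adj H j j' × ℓ j' ≡ double

record Layering (H : Graph) (doubles romans : ℕ) : Set where
  field
    layer           : Vector Layer (order H)
    blanksDominated : BlanksDominated H layer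
    #doubles-layer  : #doubles layer ≡ doubles
    #romans-layer   : #romans layer ≡ romans

module _ {G H : Graph} where

  ⊠-vertical : ∀ {g j j'} → Adj H j j' → Adj (G ⊠ H) (combine g j) (combine g j')
  ⊠-vertical {g} {j} {j'} j~j' = g , j , g , j' , refl , refl , inj₁ (refl , j~j')

  ⊠-horizontal : ∀ {g g' j} → Adj G g g' → Adj (G ⊠ H) (combine g j) (combine g' j)
  ⊠-horizontal {g} {g'} {j} g~g' = g , j , g' , j , refl , refl , inj₂ (inj₁ (g~g' , refl))

  ⊠-diagonal : ∀ {g g' j j'} → Adj G g g' → Adj H j j' →
               Adj (G ⊠ H) (combine g j) (combine g' j')
  ⊠-diagonal {g} {g'} {j} {j'} g~g' j~j' =
    g , j , g' , j' , refl , refl , inj₂ (inj₂ (g~g' , j~j'))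

  stack : Vector Layer (order H) → (φ f : Fin (order G) → ℕ) → Fin (order (G ⊠ H)) → ℕ
  stack ℓ φ f = uncurry (λ g j → layerValue (ℓ j) (φ g) (f g)) ∘ remQuot {order G} (order H)

  module _ (ℓ : Vector Layer (order H)) (φ f : Fin (order G) → ℕ) where

    stack-combine : ∀ {L} g j → ℓ j ≡ L → stack ℓ φ f (combine g j) ≡ layerValue L (φ g) (f g)
    stack-combine g j refl = cong (uncurry (λ g j → layerValue (ℓ j) (φ g) (f g)))
                                  (remQuot-combine g j)

    stack-isRDF : IsRDF G f → IsDoubledDominatingSet G φ → BlanksDominated H ℓ →
                  IsRDF (G ⊠ H) (stack ℓ φ f)
    stack-isRDF (f≤2 , f-dom) (φ-values , φ-dom) ℓ-dom = bounded , dominated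
      where
      φ≤2 : ∀ g → φ g ≤ 2
      φ≤2 g with φ-values g
      ... | inj₁ φᵍ≡0 = subst (_≤ 2) (sym φᵍ≡0) z≤n
      ... | inj₂ φᵍ≡2 = ≤-reflexive φᵍ≡2

      bounded : ∀ x → stack ℓ φ f x ≤ 2
      bounded x with ℓ (proj₂ (remQuot {order G} (order H) x))
      ... | blank  = z≤n
      ... | double = φ≤2 _
      ... | roman  = f≤2 _

      dominatedAt : ∀ g j → layerValue (ℓ j) (φ g) (f g) ≡ 0 →
                    ∃ λ y → Adj (G ⊠ H) (combine g j) y × stack ℓ φ f y ≡ 2
      dominatedAt g j value≡0 with ℓ j in ℓⱼ
      ... | roman  with f-dom g value≡0
      ...   | u , g~u , fᵤ≡2 = combine u j , ⊠-horizontal g~u , trans (stack-combine u j ℓⱼ) fᵤ≡2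
      dominatedAt g j value≡0 | double with φ-dom g value≡0
      ...   | u , g~u , φᵤ≡2 = combine u j , ⊠-horizontal g~u , trans (stack-combine u j ℓⱼ) φᵤ≡2
      dominatedAt g j value≡0 | blank  with ℓ-dom j ℓⱼ | φ-values g
      ...   | j' , j~j' , ℓⱼ' | inj₂ φᵍ≡2 =
        combine g j' , ⊠-vertical j~j' , trans (stack-combine g j' ℓⱼ') φᵍ≡2
      ...   | j' , j~j' , ℓⱼ' | inj₁ φᵍ≡0 with φ-dom g φᵍ≡0
      ...     | u , g~u , φᵤ≡2 =
        combine u j' , ⊠-diagonal g~u j~j' , trans (stack-combine u j' ℓⱼ') φᵤ≡2

      dominated : ∀ x → stack ℓ φ f x ≡ 0 → ∃ λ y → Adj (G ⊠ H) x y × stack ℓ φ f y ≡ 2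
      dominated x value≡0 =
        subst (λ x → ∃ λ y → Adj (G ⊠ H) x y × stack ℓ φ f y ≡ 2)
              (combine-remQuot {order G} (order H) x)
              (dominatedAt (proj₁ gj) (proj₂ gj) value≡0)
        where gj = remQuot {order G} (order H) x

    stack-weight : weight (G ⊠ H) (stack ℓ φ f) ≡ #doubles ℓ * weight G φ + #romans ℓ * weight G f
    stack-weight = begin
      weight (G ⊠ H) s
        ≡⟨ weight≡sum (G ⊠ H) s ⟩
      sum s
        ≡⟨ sum-combine (order G) (order H) s ⟩
      sum (λ g → sum (λ j → s (combine {order G} {order H} g j)))
        ≡⟨ sum-cong-≗ (λ g → sum-cong-≗ (λ j →
             trans (stack-combine g j refl) (layerValue-linear (ℓ j) (φ g) (f g)))) ⟩
      sum (λ g → sum (λ j → doubleMark (ℓ j) * φ g + romanMark (ℓ j) * f g))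
        ≡⟨ sum-cong-≗ (λ g → sum-linearʳ (φ g) (f g) (doubleMark ∘ ℓ) (romanMark ∘ ℓ)) ⟩
      sum (λ g → #doubles ℓ * φ g + #romans ℓ * f g)
        ≡⟨ sum-linearˡ (#doubles ℓ) (#romans ℓ) φ f ⟩
      #doubles ℓ * sum φ + #romans ℓ * sum f
        ≡⟨ cong₂ (λ a b → #doubles ℓ * a + #romans ℓ * b) (weight≡sum G φ) (weight≡sum G f) ⟨
      #doubles ℓ * weight G φ + #romans ℓ * weight G f
        ∎
      where
      open ≡-Reasoning
      s = stack ℓ φ f

  γR-⊠-≤ : ∀ {γ d r f φ} → IsRomanDominationNumber (G ⊠ H) γ →
           IsRDF G f → IsDoubledDominatingSet G φ → Layering H d r →
           γ ≤ d * weight G φ + r * weight G f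
  γR-⊠-≤ {γ} {f = f} {φ} (_ , minimal) f-rdf φ-dds L =
    subst (γ ≤_)
      (trans (stack-weight layer φ f)
             (cong₂ (λ d r → d * weight G φ + r * weight G f) #doubles-layer #romans-layer))
      (minimal _ (stack-isRDF layer φ f f-rdf φ-dds blanksDominated))
    where open Layering L

-- Layerings of paths and cycles

pathAdj-shift : ∀ {m n} (e : Fin m → Fin n) c → (∀ i → toℕ (e i) ≡ c + toℕ i) →
                ∀ {i j} → pathAdj m i j → pathAdj n (e i) (e j)
pathAdj-shift e c toℕ-e = map-⊎ shifted shifted
  where
  shifted : ∀ {i j} → toℕ j ≡ suc (toℕ i) → toℕ (e j) ≡ suc (toℕ (e i))
  shifted {i} {j} j≡1+i = begin
    toℕ (e j)          ≡⟨ toℕ-e j ⟩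
    c + toℕ j          ≡⟨ cong (_+_ c) j≡1+i ⟩
    c + suc (toℕ i)    ≡⟨ +-suc c (toℕ i) ⟩
    suc (c + toℕ i)    ≡⟨ cong suc (toℕ-e i) ⟨
    suc (toℕ (e i))    ∎
    where open ≡-Reasoning

++-blanksDominated : ∀ {m n} {xs : Vector Layer m} {ys : Vector Layer n} →
  BlanksDominated (pathGraph m) xs → BlanksDominated (pathGraph n) ys →
  BlanksDominated (pathGraph (m + n)) (xs ++ ys)
++-blanksDominated {m} {n} {xs} {ys} xs-dom ys-dom i blankᵢ with splitAt m i in split
... | inj₁ a with xs-dom a blankᵢ
...   | b , a~b , xs-b =
  b ↑ˡ n ,
  subst (λ i → pathAdj (m + n) i (b ↑ˡ n)) (splitAt⁻¹-↑ˡ split)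
        (pathAdj-shift (_↑ˡ n) 0 (λ i → toℕ-↑ˡ i n) a~b) ,
  trans (lookup-++ˡ xs ys b) xs-b
++-blanksDominated {m} {n} {xs} {ys} xs-dom ys-dom i blankᵢ | inj₂ a with ys-dom a blankᵢ
...   | b , a~b , ys-b =
  m ↑ʳ b ,
  subst (λ i → pathAdj (m + n) i (m ↑ʳ b)) (splitAt⁻¹-↑ʳ split)
        (pathAdj-shift (m ↑ʳ_) m (toℕ-↑ʳ m) a~b) ,
  trans (lookup-++ʳ xs ys b) ys-b

_++ᴸ_ : ∀ {m n d d' r r'} → Layering (pathGraph m) d r → Layering (pathGraph n) d' r' →
        Layering (pathGraph (m + n)) (d + d') (r + r')
L ++ᴸ L' = record
  { layer           = layer L ++ layer L'
  ; blanksDominated = ++-blanksDominated (blanksDominated L) (blanksDominated L')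
  ; #doubles-layer  = trans (sum-map-++ doubleMark (layer L) (layer L'))
                            (cong₂ _+_ (#doubles-layer L) (#doubles-layer L'))
  ; #romans-layer   = trans (sum-map-++ romanMark (layer L) (layer L'))
                            (cong₂ _+_ (#romans-layer L) (#romans-layer L'))
  }
  where open Layering

emptyLayering : Layering (pathGraph 0) 0 0
emptyLayering = record { layer = [] ; blanksDominated = λ () ; #doubles-layer = refl ; #romans-layer = refl }

blocks : ∀ k → Layering (pathGraph (k * 3)) k 0
blocks zero    = emptyLayering
blocks (suc k) = block ++ᴸ blocks k
  where
  block : Layering (pathGraph 3) 1 0
  block = record
    { layer           = blank ∷ double ∷ blank ∷ []
    ; blanksDominated = λ { zero _ → suc zero , inj₁ refl , refl
                          ; (suc zero) ()
                          ; (suc (suc zero)) _ → suc zero , inj₂ refl , refl }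
    ; #doubles-layer  = refl
    ; #romans-layer   = refl
    }

residueDoubles residueRomans : Fin 3 → ℕ
residueDoubles (suc (suc zero)) = 1
residueDoubles _                = 0
residueRomans (suc zero) = 1
residueRomans _          = 0

residueLayering : ∀ r → Layering (pathGraph (toℕ r)) (residueDoubles r) (residueRomans r)
residueLayering zero             = emptyLayering
residueLayering (suc zero)       = record
  { layer = roman ∷ [] ; blanksDominated = λ { zero () } ; #doubles-layer = refl ; #romans-layer = refl }
residueLayering (suc (suc zero)) = record
  { layer = blank ∷ double ∷ [] ; blanksDominated = λ { zero _ → suc zero , inj₁ refl , refl ; (suc zero) () }
  ; #doubles-layer = refl ; #romans-layer = refl }

pathLayering : ∀ r k →
  Layering (pathGraph (toℕ r + k * 3)) (residueDoubles r + k) (residueRomans r + 0)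
pathLayering r k = residueLayering r ++ᴸ blocks k

castLayering : ∀ {m n d r} → m ≡ n → Layering (pathGraph m) d r → Layering (pathGraph n) d r
castLayering refl L = L

pathLike-layering : ∀ {n H d r} → (H ≡ pathGraph n × 1 ≤ n) ⊎ (H ≡ cycleGraph n × 3 ≤ n) →
                    Layering (pathGraph n) d r → Layering H d r
pathLike-layering (inj₁ (refl , _)) L = L
pathLike-layering (inj₂ (refl , _)) L = record
  { layer           = layer
  ; blanksDominated = λ j blankⱼ → map₂ (map₁ inj₁) (blanksDominated j blankⱼ)
  ; #doubles-layer  = #doubles-layer
  ; #romans-layer   = #romans-layer
  }
  where open Layering L

[q*3+r]/3≡q : ∀ q {r} → r < 3 → (q * 3 + r) / 3 ≡ q
[q*3+r]/3≡q zero    r<3 = m<n⇒m/n≡0 r<3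
[q*3+r]/3≡q (suc q) {r} r<3 =
  trans (m/n≡1+[m∸n]/n {suc q * 3 + r} (s≤s (s≤s (s≤s z≤n)))) (cong suc ([q*3+r]/3≡q q r<3))

doubling-bound : ∀ {Φ γ} → Φ + 2 ≤ 2 * γ → ∀ c → c * Φ + 2 * c ≤ 2 * c * γ
doubling-bound {Φ} {γ} Φ+2≤2γ c = begin
  c * Φ + 2 * c   ≡⟨ cong (_+_ (c * Φ)) (*-comm 2 c) ⟩
  c * Φ + c * 2   ≡⟨ *-distribˡ-+ c Φ 2 ⟨
  c * (Φ + 2)     ≤⟨ *-monoʳ-≤ c Φ+2≤2γ ⟩
  c * (2 * γ)     ≡⟨ *-assoc c 2 γ ⟨
  c * 2 * γ       ≡⟨ cong (_* γ) (*-comm c 2) ⟩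
  2 * c * γ       ∎
  where open ≤-Reasoning

bound-from-layeringWeight : ∀ (r : Fin 3) k {n γ Φ w} → n ≡ toℕ r + k * 3 → Φ + 2 ≤ 2 * γ →
  w ≤ (residueDoubles r + k) * Φ + (residueRomans r + 0) * γ →
  (toℕ r ≡ 1 → w + 2 * k ≤ ((2 * n + 1) / 3) * γ) ×
  (¬ toℕ r ≡ 1 → w + 2 * k ≤ 2 * ⌈ n /3⌉ * γ)
bound-from-layeringWeight zero k {γ = γ} {Φ} {w} refl Φ+2≤2γ w≤ = (λ ()) , λ _ → begin
  w + 2 * k                 ≤⟨ +-monoˡ-≤ (2 * k) w≤ ⟩
  k * Φ + 0 + 2 * k         ≡⟨ cong (_+ 2 * k) (+-identityʳ (k * Φ)) ⟩
  k * Φ + 2 * k             ≤⟨ doubling-bound Φ+2≤2γ k ⟩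
  2 * k * γ                 ≡⟨ cong (λ q → 2 * q * γ) ([q*3+r]/3≡q k (s≤s (s≤s (s≤s z≤n)))) ⟨
  2 * ⌈ k * 3 /3⌉ * γ       ∎
  where open ≤-Reasoning
bound-from-layeringWeight (suc zero) k {γ = γ} {Φ} {w} refl Φ+2≤2γ w≤ = (λ _ → begin
  w + 2 * k                      ≤⟨ +-monoˡ-≤ (2 * k) w≤ ⟩
  k * Φ + 1 * γ + 2 * k          ≡⟨ solve 3 (λ k Φ γ → k :* Φ :+ con 1 :* γ :+ con 2 :* k
                                               := k :* Φ :+ con 2 :* k :+ γ) refl k Φ γ ⟩
  k * Φ + 2 * k + γ              ≤⟨ +-monoˡ-≤ γ (doubling-bound Φ+2≤2γ k) ⟩
  2 * k * γ + γ                  ≡⟨ solve 2 (λ k γ → con 2 :* k :* γ :+ γ := (con 2 :* k :+ con 1) :* γ) refl k γ ⟩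
  (2 * k + 1) * γ                ≡⟨ cong (_* γ) 2n+1/3≡2k+1 ⟨
  ((2 * suc (k * 3) + 1) / 3) * γ ∎) , λ 1≢1 → contradiction refl 1≢1
  where
  open ≤-Reasoning
  open +-*-Solver
  2n+1/3≡2k+1 : (2 * suc (k * 3) + 1) / 3 ≡ 2 * k + 1
  2n+1/3≡2k+1 = trans (/-congˡ {o = 3} (solve 1 (λ k → con 2 :* (con 1 :+ k :* con 3) :+ con 1
                                          := (con 2 :* k :+ con 1) :* con 3 :+ con 0) refl k))
                      ([q*3+r]/3≡q (2 * k + 1) (s≤s z≤n))
bound-from-layeringWeight (suc (suc zero)) k {γ = γ} {Φ} {w} refl Φ+2≤2γ w≤ = (λ ()) , λ _ → begin
  w + 2 * k                          ≤⟨ +-monoʳ-≤ w (*-monoʳ-≤ 2 (n≤1+n k)) ⟩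
  w + 2 * suc k                      ≤⟨ +-monoˡ-≤ (2 * suc k) w≤ ⟩
  suc k * Φ + 0 + 2 * suc k          ≡⟨ cong (_+ 2 * suc k) (+-identityʳ (suc k * Φ)) ⟩
  suc k * Φ + 2 * suc k              ≤⟨ doubling-bound Φ+2≤2γ (suc k) ⟩
  2 * suc k * γ                      ≡⟨ cong (λ q → 2 * q * γ) ⌈n/3⌉≡1+k ⟨
  2 * ⌈ 2 + k * 3 /3⌉ * γ            ∎
  where
  open ≤-Reasoning
  open +-*-Solver
  ⌈n/3⌉≡1+k : ⌈ 2 + k * 3 /3⌉ ≡ suc k
  ⌈n/3⌉≡1+k = trans (/-congˡ {o = 3} (solve 1 (λ k → con 2 :+ k :* con 3 :+ con 2
                                        := (con 1 :+ k) :* con 3 :+ con 1) refl k))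
                    ([q*3+r]/3≡q (suc k) (s≤s (s≤s z≤n)))

+≤+-minus : ∀ {a b c} → a + c ≤ b → + a ≤ℤ + b - + c
+≤+-minus {a} {b} {c} a+c≤b =
  subst (+ a ≤ℤ_) (sym (trans (m-n≡m⊖n b c) (⊖-≥ (≤-trans (m≤n+m c a) a+c≤b))))
        (+≤+ (m+n≤o⇒m≤o∸n a a+c≤b))

corollary25 : (G : Graph) → IsSimple G → NonEmpty G →
    (n : ℕ) (H : Graph) →
    ((H ≡ pathGraph n × 1 ≤ n) ⊎ (H ≡ cycleGraph n × 3 ≤ n)) →
    (γG γGH : ℕ) → IsRomanDominationNumber G γG →
    IsRomanDominationNumber (G ⊠ H) γGH →
    (n % 3 ≡ 1 → + γGH ≤ℤ + (((2 * n + 1) / 3) * γG) - + (2 * (n / 3))) ×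
    (¬ (n % 3 ≡ 1) → + γGH ≤ℤ + (2 * ⌈ n /3⌉ * γG) - + (2 * (n / 3)))
corollary25 G simple nonEmpty n H pathLike _ γGH ((f , f-rdf , refl) , _) γR-GH
  with smallerDominatingSet simple nonEmpty f-rdf
... | φ , φ-dds , φ+2≤2γ =
  (λ n%3≡1 → +≤+-minus (proj₁ bounds (trans r≡n%3 n%3≡1))) ,
  (λ n%3≢1 → +≤+-minus (proj₂ bounds (n%3≢1 ∘ trans (sym r≡n%3))))
  where
  r : Fin 3
  r = n mod 3
  k : ℕ
  k = n / 3
  r≡n%3 : toℕ r ≡ n % 3
  r≡n%3 = toℕ-fromℕ< (m%n<n n 3)
  n≡r+k*3 : n ≡ toℕ r + k * 3
  n≡r+k*3 = trans (m≡m%n+[m/n]*n n 3) (cong (_+ k * 3) (sym r≡n%3))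
  layering : Layering H (residueDoubles r + k) (residueRomans r + 0)
  layering = pathLike-layering pathLike (castLayering (sym n≡r+k*3) (pathLayering r k))
  bounds : (toℕ r ≡ 1 → γGH + 2 * k ≤ ((2 * n + 1) / 3) * weight G f) ×
           (¬ toℕ r ≡ 1 → γGH + 2 * k ≤ 2 * ⌈ n /3⌉ * weight G f)
  bounds = bound-from-layeringWeight r k n≡r+k*3 φ+2≤2γ (γR-⊠-≤ γR-GH f-rdf φ-dds layering)
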